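{- Let $n\ge 4$ and let $\tilde{D}_n$ be the graph on the vertices $1,2,\ldots,n+1$ with edge set $\{1,3\},\{2,3\},\{n-1,n\},\{n-1,n+1\}$ and $\{i,i+1\}$ for $3\le i\le n-2$, with adjacency matrix $A$ and walk matrix $W(\tilde{D}_n)=\begin{bmatrix} e_{n+1} & Ae_{n+1} & \cdots & A^{n}e_{n+1}\end{bmatrix}$ ($e_m$ denotes the all-ones vector of length $m$). Let $\hat{W}(\tilde{D}_n)$ be the $(n-1)\times(n-1)$ matrix obtained from $W(\tilde{D}_n)$ by deleting its first and last rows and its last two columns. Let $B$ be the $(n-1)\times(n-1)$ matrix with $B_{ij}=0$ unless $|i-j|=1$, and for $1\le i\le n-2$: $B_{i,i+1}=2$ if $i=n-2$ and $1$ otherwise; $B_{i+1,i}=2$ if $i=1$ and $1$ otherwise. Let $W(B)=\begin{bmatrix} e_{n-1} & Be_{n-1} & \cdots & B^{n-2}e_{n-1}\end{bmatrix}$. Then $\hat{W}(\tilde{D}_n)=W(B)$. -}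

module Defs where

open import Data.Nat using (ℕ; zero; suc; _+_; _*_; _∸_; _≡ᵇ_; _≤ᵇ_)
open import Data.Bool using (Bool; true; false; if_then_else_; _∨_; _∧_)
open import Data.Fin using (Fin; toℕ)

-- Square matrices of size m over ℕ, indexed by Fin m (0-based indices;
-- index i corresponds to the paper's 1-based index i+1).
Mat : ℕ → Set
Mat m = Fin m → Fin m → ℕ

Vec' : ℕ → Set
Vec' m = Fin m → ℕ

sumFin : (m : ℕ) → (Fin m → ℕ) → ℕ
sumFin zero    f = 0
sumFin (suc m) f = f Fin.zero + sumFin m (λ i → f (Fin.suc i))

_·_ : {m : ℕ} → Mat m → Vec' m → Vec' m
_·_ {m} M v i = sumFin m (λ j → M i j * v j)

ones : (m : ℕ) → Vec' m
ones m _ = 1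

pow· : {m : ℕ} → Mat m → ℕ → Vec' m → Vec' m
pow· M zero    v = v
pow· M (suc k) v = M · pow· M k v

-- walk matrix entry: W(M)_{i,k} = (M^k e_m)_i  (row i, column k, 0-based);
-- the full walk matrix of an m×m matrix has columns k = 0,…,m-1.
walk : {m : ℕ} → Mat m → ℕ → Fin m → ℕ
walk {m} M k i = pow· M k (ones m) i

isEdgeDir : ℕ → ℕ → ℕ → Bool
isEdgeDir n a b =
     ((a ≡ᵇ 1) ∧ (b ≡ᵇ 3))
  ∨ ((a ≡ᵇ 2) ∧ (b ≡ᵇ 3))
  ∨ ((a ≡ᵇ (n ∸ 1)) ∧ (b ≡ᵇ n))
  ∨ ((a ≡ᵇ (n ∸ 1)) ∧ (b ≡ᵇ suc n))
  ∨ ((b ≡ᵇ suc a) ∧ (3 ≤ᵇ a) ∧ (a ≤ᵇ (n ∸ 2)))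

isEdge : ℕ → ℕ → ℕ → Bool
isEdge n a b = isEdgeDir n a b ∨ isEdgeDir n b a

b2n : Bool → ℕ
b2n true  = 1
b2n false = 0

adjD : (n : ℕ) → Mat (suc n)
adjD n i j = b2n (isEdge n (suc (toℕ i)) (suc (toℕ j)))

entryB : ℕ → ℕ → ℕ → ℕ
entryB n p q =
  if (q ≡ᵇ suc p) then (if (p ≡ᵇ (n ∸ 2)) then 2 else 1)
  else if (p ≡ᵇ suc q) then (if (q ≡ᵇ 1) then 2 else 1)
  else 0

matB : (n : ℕ) → Mat (n ∸ 1)
matB n i j = entryB n (suc (toℕ i)) (suc (toℕ j))

module Submission where

-- The partition {1,2}, {3}, {4}, …, {n-1}, {n,n+1} of the vertices of D̃_n is equitable:
-- a vertex in cell p has exactly B_pq neighbours in cell q.  Hence A (V ∘ cell) = (B V) ∘ cell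
-- for every V, and by induction on k the walk counts (A^k e)_v depend only on the cell of v,
-- where they equal (B^k e)_(cell v).  Deleting the first and last rows of W(D̃_n) keeps exactly
-- one vertex of each cell, in order, so Ŵ(D̃_n) = W(B) (in every column, not only the first n-1).

open import Defs
open import Data.Nat using (ℕ; zero; suc; _+_; _*_; _∸_; _≤_; _≰_; _<_; z≤n; s≤s; _⊓_; pred; _≡ᵇ_)
open import Data.Nat.Properties
open import Data.Nat.Tactic.RingSolver using (solve-∀)
open import Data.Bool using (true; false)
open import Data.Fin using (Fin; toℕ; fromℕ<)
open import Data.Fin.Properties using (toℕ-fromℕ<)
open import Data.Product using (_,_)
open import Data.Sum using (_⊎_; inj₁; inj₂)
open import Function using (_∘_)
open import Relation.Nullary using (Dec; does; yes; no; ¬_; _×-dec_; _⊎-dec_)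
open import Relation.Nullary.Decidable using (map′; dec-true; dec-false)
open import Relation.Binary.PropositionalEquality

sumᴺ : ℕ → (ℕ → ℕ) → ℕ
sumᴺ zero    f = 0
sumᴺ (suc k) f = f 0 + sumᴺ k (λ j → f (suc j))

sumFin≡sumᴺ : ∀ m (f : ℕ → ℕ) → sumFin m (λ i → f (toℕ i)) ≡ sumᴺ m f
sumFin≡sumᴺ zero    f = refl
sumFin≡sumᴺ (suc m) f = cong (f 0 +_) (sumFin≡sumᴺ m (λ j → f (suc j)))

sumFin-cong : ∀ m {f g : Fin m → ℕ} → (∀ j → f j ≡ g j) → sumFin m f ≡ sumFin m g
sumFin-cong zero    f≗g = refl
sumFin-cong (suc m) f≗g = cong₂ _+_ (f≗g Fin.zero) (sumFin-cong m (λ j → f≗g (Fin.suc j)))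

sumᴺ-cong : ∀ k {f g : ℕ → ℕ} → (∀ j → j < k → f j ≡ g j) → sumᴺ k f ≡ sumᴺ k g
sumᴺ-cong zero    f≗g = refl
sumᴺ-cong (suc k) f≗g = cong₂ _+_ (f≗g 0 (s≤s z≤n)) (sumᴺ-cong k (λ j j<k → f≗g (suc j) (s≤s j<k)))

sumᴺ-last : ∀ k f → sumᴺ (suc k) f ≡ sumᴺ k f + f k
sumᴺ-last zero    f = +-identityʳ (f 0)
sumᴺ-last (suc k) f = begin
  f 0 + sumᴺ (suc k) (λ j → f (suc j))  ≡⟨ cong (f 0 +_) (sumᴺ-last k (λ j → f (suc j))) ⟩
  f 0 + (sumᴺ k (λ j → f (suc j)) + f (suc k)) ≡⟨ +-assoc (f 0) _ _ ⟨
  f 0 + sumᴺ k (λ j → f (suc j)) + f (suc k)   ∎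
  where open ≡-Reasoning

sumᴺ-ends : ∀ k h → sumᴺ (2 + k) h ≡ h 0 + sumᴺ k (λ t → h (suc t)) + h (suc k)
sumᴺ-ends k h = trans (cong (h 0 +_) (sumᴺ-last k (λ t → h (suc t)))) (sym (+-assoc (h 0) _ _))

-- Indexing by ℕ rather than Fin lets the quotient map below be an arbitrary ℕ → ℕ.
walkᴺ : (ℕ → ℕ → ℕ) → ℕ → ℕ → ℕ → ℕ
walkᴺ a M zero    i = 1
walkᴺ a M (suc k) i = sumᴺ M (λ j → a i j * walkᴺ a M k j)

walk≡walkᴺ : ∀ {M} (a : ℕ → ℕ → ℕ) k (i : Fin M) →
  walk {M} (λ x y → a (toℕ x) (toℕ y)) k i ≡ walkᴺ a M k (toℕ i)
walk≡walkᴺ     a zero    i = refl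
walk≡walkᴺ {M} a (suc k) i = begin
  sumFin M (λ j → a (toℕ i) (toℕ j) * walk _ k j)
    ≡⟨ sumFin-cong M (λ j → cong (a (toℕ i) (toℕ j) *_) (walk≡walkᴺ a k j)) ⟩
  sumFin M (λ j → a (toℕ i) (toℕ j) * walkᴺ a M k (toℕ j))
    ≡⟨ sumFin≡sumᴺ M (λ j → a (toℕ i) j * walkᴺ a M k j) ⟩
  walkᴺ a M (suc k) (toℕ i) ∎
  where open ≡-Reasoning

Intertwines : (a : ℕ → ℕ → ℕ) (M : ℕ) (b : ℕ → ℕ → ℕ) (N : ℕ) (φ : ℕ → ℕ) → Set
Intertwines a M b N φ =
  ∀ i → i < M → (V : ℕ → ℕ) → sumᴺ M (λ j → a i j * V (φ j)) ≡ sumᴺ N (λ q → b (φ i) q * V q)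

walkᴺ-quotient : ∀ {a M b N φ} → Intertwines a M b N φ →
  ∀ k i → i < M → walkᴺ a M k i ≡ walkᴺ b N k (φ i)
walkᴺ-quotient                     aφ≡φb zero    i i<M = refl
walkᴺ-quotient {a} {M} {b} {N} {φ} aφ≡φb (suc k) i i<M = begin
  sumᴺ M (λ j → a i j * walkᴺ a M k j)
    ≡⟨ sumᴺ-cong M (λ j j<M → cong (a i j *_) (walkᴺ-quotient aφ≡φb k j j<M)) ⟩
  sumᴺ M (λ j → a i j * walkᴺ b N k (φ j))
    ≡⟨ aφ≡φb i i<M (walkᴺ b N k) ⟩
  sumᴺ N (λ q → b (φ i) q * walkᴺ b N k q) ∎
  where open ≡-Reasoning

data Edge (n : ℕ) : ℕ → ℕ → Set where
  edge-1-3   : Edge n 1 3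
  edge-2-3   : Edge n 2 3
  edge-end   : Edge n (n ∸ 1) n
  edge-end′  : Edge n (n ∸ 1) (suc n)
  edge-path  : ∀ {a} → 3 ≤ a → a ≤ n ∸ 2 → Edge n a (suc a)

-- `does (edge? n a b)` is definitionally `isEdgeDir n a b`, since `does (a ≟ b)` is `a ≡ᵇ b`
-- and `does (a ≤? b)` is `a ≤ᵇ b`.
edge? : ∀ n a b → Dec (Edge n a b)
edge? n a b = map′ fromSum toSum
    ((a ≟ 1 ×-dec b ≟ 3)
  ⊎-dec (a ≟ 2 ×-dec b ≟ 3)
  ⊎-dec (a ≟ n ∸ 1 ×-dec b ≟ n)
  ⊎-dec (a ≟ n ∸ 1 ×-dec b ≟ suc n)
  ⊎-dec (b ≟ suc a ×-dec 3 ≤? a ×-dec a ≤? n ∸ 2))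
  where
  fromSum : _ → Edge n a b
  fromSum (inj₁ (refl , refl)) = edge-1-3
  fromSum (inj₂ (inj₁ (refl , refl))) = edge-2-3
  fromSum (inj₂ (inj₂ (inj₁ (refl , refl)))) = edge-end
  fromSum (inj₂ (inj₂ (inj₂ (inj₁ (refl , refl))))) = edge-end′
  fromSum (inj₂ (inj₂ (inj₂ (inj₂ (refl , 3≤a , a≤n-2))))) = edge-path 3≤a a≤n-2
  toSum : Edge n a b → _
  toSum edge-1-3 = inj₁ (refl , refl)
  toSum edge-2-3 = inj₂ (inj₁ (refl , refl))
  toSum edge-end = inj₂ (inj₂ (inj₁ (refl , refl)))
  toSum edge-end′ = inj₂ (inj₂ (inj₂ (inj₁ (refl , refl))))
  toSum (edge-path 3≤a a≤n-2) = inj₂ (inj₂ (inj₂ (inj₂ (refl , 3≤a , a≤n-2))))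

Adjacent : ℕ → ℕ → ℕ → Set
Adjacent n a b = Edge n a b ⊎ Edge n b a

adjacent? : ∀ n a b → Dec (Adjacent n a b)
adjacent? n a b = edge? n a b ⊎-dec edge? n b a

-- Both matrices are taken at n = 4 + m, so that n ∸ 1 and n ∸ 2 compute, and 0-based:
-- index i stands for the paper's vertex (or row) i + 1.
adjDᴺ : ℕ → ℕ → ℕ → ℕ
adjDᴺ m i j = b2n (isEdge (4 + m) (suc i) (suc j))

matBᴺ : ℕ → ℕ → ℕ → ℕ
matBᴺ m p q = entryB (4 + m) (suc p) (suc q)

adjDᴺ-adjacent : ∀ m i j → Adjacent (4 + m) (suc i) (suc j) → adjDᴺ m i j ≡ 1
adjDᴺ-adjacent m i j adj = cong b2n (dec-true (adjacent? (4 + m) (suc i) (suc j)) adj)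

adjDᴺ-nonadjacent : ∀ m i j → ¬ Adjacent (4 + m) (suc i) (suc j) → adjDᴺ m i j ≡ 0
adjDᴺ-nonadjacent m i j ¬adj = cong b2n (dec-false (adjacent? (4 + m) (suc i) (suc j)) ¬adj)

≡ᵇ-true : ∀ {a b} → a ≡ b → (a ≡ᵇ b) ≡ true
≡ᵇ-true {a} {b} = dec-true (a ≟ b)

≡ᵇ-false : ∀ {a b} → a ≢ b → (a ≡ᵇ b) ≡ false
≡ᵇ-false {a} {b} = dec-false (a ≟ b)

matBᴺ-super : ∀ {m s} → s ≢ m → matBᴺ m (suc s) (2 + s) ≡ 1
matBᴺ-super {s = s} s≢m rewrite ≡ᵇ-true (refl {x = s}) | ≡ᵇ-false s≢m = refl

matBᴺ-super-last : ∀ m → matBᴺ m (suc m) (2 + m) ≡ 2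
matBᴺ-super-last m rewrite ≡ᵇ-true (refl {x = m}) = refl

matBᴺ-sub : ∀ m t → matBᴺ m (2 + t) (suc t) ≡ 1
matBᴺ-sub m t rewrite ≡ᵇ-false (<⇒≢ (m≤n⇒m≤1+n (n<1+n t))) | ≡ᵇ-true (refl {x = t}) = refl

matBᴺ-off : ∀ m p q → q ≢ suc p → p ≢ suc q → matBᴺ m p q ≡ 0
matBᴺ-off m p q q≢1+p p≢1+q rewrite ≡ᵇ-false q≢1+p | ≡ᵇ-false p≢1+q = refl

record QuotientRow (m i p : ℕ) : Set where
  field
    first-cell : adjDᴺ m i 0 + adjDᴺ m i 1 ≡ matBᴺ m p 0
    path-cell  : ∀ t → t ≤ m → adjDᴺ m i (2 + t) ≡ matBᴺ m p (suc t)
    last-cell  : adjDᴺ m i (3 + m) + adjDᴺ m i (4 + m) ≡ matBᴺ m p (2 + m)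

quotientRow-start₁ : ∀ m → QuotientRow m 0 0
quotientRow-start₁ m = record
  { first-cell = cong₂ _+_ (adjDᴺ-nonadjacent m 0 0 λ { (inj₁ ()) ; (inj₂ ()) })
                           (adjDᴺ-nonadjacent m 0 1 λ { (inj₁ (edge-path (s≤s ()) _)) ; (inj₂ ()) })
  ; path-cell  = λ { zero _ → adjDᴺ-adjacent m 0 2 (inj₁ edge-1-3)
                   ; (suc t) _ → adjDᴺ-nonadjacent m 0 (3 + t) λ { (inj₁ ()) ; (inj₂ ()) } }
  ; last-cell  = cong₂ _+_ (adjDᴺ-nonadjacent m 0 (3 + m) λ { (inj₁ ()) ; (inj₂ ()) })
                           (adjDᴺ-nonadjacent m 0 (4 + m) λ { (inj₁ ()) ; (inj₂ ()) })
  }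

quotientRow-start₂ : ∀ m → QuotientRow m 1 0
quotientRow-start₂ m = record
  { first-cell = cong₂ _+_ (adjDᴺ-nonadjacent m 1 0 λ { (inj₁ ()) ; (inj₂ (edge-path (s≤s ()) _)) })
                           (adjDᴺ-nonadjacent m 1 1 λ { (inj₁ ()) ; (inj₂ ()) })
  ; path-cell  = λ { zero _ → adjDᴺ-adjacent m 1 2 (inj₁ edge-2-3)
                   ; (suc t) _ → adjDᴺ-nonadjacent m 1 (3 + t) λ { (inj₁ ()) ; (inj₂ ()) } }
  ; last-cell  = cong₂ _+_ (adjDᴺ-nonadjacent m 1 (3 + m) λ { (inj₁ ()) ; (inj₂ ()) })
                           (adjDᴺ-nonadjacent m 1 (4 + m) λ { (inj₁ ()) ; (inj₂ ()) })
  }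

2+n≰n : ∀ {n} → 2 + n ≰ n
2+n≰n 2+n≤n = 1+n≰n (≤-trans (n≤1+n _) 2+n≤n)

quotientRow-path : ∀ m s → s ≤ m → QuotientRow m (2 + s) (suc s)
quotientRow-path m s s≤m = record
  { first-cell = first-cell s
  ; path-cell  = path-cell
  ; last-cell  = last-cell
  }
  where
  first-cell : ∀ s → adjDᴺ m (2 + s) 0 + adjDᴺ m (2 + s) 1 ≡ matBᴺ m (suc s) 0
  first-cell zero    = cong₂ _+_ (adjDᴺ-adjacent m 2 0 (inj₂ edge-1-3))
                                 (adjDᴺ-adjacent m 2 1 (inj₂ edge-2-3))
  first-cell (suc s) = cong₂ _+_ (adjDᴺ-nonadjacent m (3 + s) 0 λ { (inj₁ ()) ; (inj₂ ()) })
                                 (adjDᴺ-nonadjacent m (3 + s) 1 λ { (inj₁ ()) ; (inj₂ ()) })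

  path-cell : ∀ t → t ≤ m → adjDᴺ m (2 + s) (2 + t) ≡ matBᴺ m (suc s) (suc t)
  path-cell t t≤m with t ≟ suc s | s ≟ suc t
  ... | yes refl | _        =
    trans (adjDᴺ-adjacent m (2 + s) (3 + s) (inj₁ (edge-path (m≤m+n 3 s) (s≤s (s≤s t≤m)))))
          (sym (matBᴺ-super (<⇒≢ t≤m)))
  ... | no _     | yes refl =
    trans (adjDᴺ-adjacent m (3 + t) (2 + t) (inj₂ (edge-path (m≤m+n 3 t) (s≤s (s≤s s≤m)))))
          (sym (matBᴺ-sub m t))
  ... | no t≢1+s | no s≢1+t =
    trans (adjDᴺ-nonadjacent m (2 + s) (2 + t) ¬adjacent)
          (sym (matBᴺ-off m (suc s) (suc t) (t≢1+s ∘ suc-injective) (s≢1+t ∘ suc-injective)))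
    where
    ¬adjacent : ¬ Adjacent (4 + m) (3 + s) (3 + t)
    ¬adjacent (inj₁ edge-end)        = 1+n≰n t≤m
    ¬adjacent (inj₁ edge-end′)       = 2+n≰n t≤m
    ¬adjacent (inj₁ (edge-path _ _)) = t≢1+s refl
    ¬adjacent (inj₂ edge-end)        = 1+n≰n s≤m
    ¬adjacent (inj₂ edge-end′)       = 2+n≰n s≤m
    ¬adjacent (inj₂ (edge-path _ _)) = s≢1+t refl

  last-cell : adjDᴺ m (2 + s) (3 + m) + adjDᴺ m (2 + s) (4 + m) ≡ matBᴺ m (suc s) (2 + m)
  last-cell with s ≟ m
  ... | yes refl = trans (cong₂ _+_ (adjDᴺ-adjacent m (2 + s) (3 + s) (inj₁ edge-end))
                                    (adjDᴺ-adjacent m (2 + s) (4 + s) (inj₁ edge-end′)))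
                         (sym (matBᴺ-super-last s))
  ... | no s≢m   = trans (cong₂ _+_ (adjDᴺ-nonadjacent m (2 + s) (3 + m) ¬adjacent-end)
                                    (adjDᴺ-nonadjacent m (2 + s) (4 + m) ¬adjacent-end′))
                         (sym (matBᴺ-off m (suc s) (2 + m) (s≢m ∘ sym ∘ suc-injective ∘ suc-injective)
                                                           (<⇒≢ (s≤s (s≤s (m≤n⇒m≤1+n s≤m))))))
    where
    ¬adjacent-end : ¬ Adjacent (4 + m) (3 + s) (4 + m)
    ¬adjacent-end (inj₁ edge-end)        = s≢m refl
    ¬adjacent-end (inj₁ (edge-path _ _)) = s≢m refl
    ¬adjacent-end (inj₂ (edge-path _ _)) = 2+n≰n s≤m
    ¬adjacent-end′ : ¬ Adjacent (4 + m) (3 + s) (5 + m)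
    ¬adjacent-end′ (inj₁ edge-end′)       = s≢m refl
    ¬adjacent-end′ (inj₁ (edge-path _ _)) = 1+n≰n s≤m
    ¬adjacent-end′ (inj₂ (edge-path _ _)) = 2+n≰n (≤-trans (n≤1+n _) s≤m)

quotientRow-end₁ : ∀ m → QuotientRow m (3 + m) (2 + m)
quotientRow-end₁ m = record
  { first-cell = cong₂ _+_ (adjDᴺ-nonadjacent m (3 + m) 0 λ { (inj₁ ()) ; (inj₂ ()) })
                           (adjDᴺ-nonadjacent m (3 + m) 1 λ { (inj₁ ()) ; (inj₂ ()) })
  ; path-cell  = path-cell
  ; last-cell  = trans (cong₂ _+_ (adjDᴺ-nonadjacent m (3 + m) (3 + m) λ { (inj₁ ()) ; (inj₂ ()) })
                                  (adjDᴺ-nonadjacent m (3 + m) (4 + m)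
                                     λ { (inj₁ (edge-path _ 4+m≤2+m)) → 2+n≰n 4+m≤2+m ; (inj₂ ()) }))
                       (sym (matBᴺ-off m (2 + m) (2 + m) (1+n≢n ∘ sym) (1+n≢n ∘ sym)))
  }
  where
  path-cell : ∀ t → t ≤ m → adjDᴺ m (3 + m) (2 + t) ≡ matBᴺ m (2 + m) (suc t)
  path-cell t t≤m with t ≟ m
  ... | yes refl = trans (adjDᴺ-adjacent m (3 + t) (2 + t) (inj₂ edge-end)) (sym (matBᴺ-sub t t))
  ... | no t≢m   = trans (adjDᴺ-nonadjacent m (3 + m) (2 + t) ¬adjacent)
                         (sym (matBᴺ-off m (2 + m) (suc t) (<⇒≢ (s≤s (s≤s (m≤n⇒m≤1+n t≤m))))
                                                           (t≢m ∘ sym ∘ suc-injective ∘ suc-injective)))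
    where
    ¬adjacent : ¬ Adjacent (4 + m) (4 + m) (3 + t)
    ¬adjacent (inj₁ (edge-path _ _)) = 2+n≰n t≤m
    ¬adjacent (inj₂ edge-end)        = t≢m refl
    ¬adjacent (inj₂ (edge-path _ _)) = t≢m refl

quotientRow-end₂ : ∀ m → QuotientRow m (4 + m) (2 + m)
quotientRow-end₂ m = record
  { first-cell = cong₂ _+_ (adjDᴺ-nonadjacent m (4 + m) 0 λ { (inj₁ ()) ; (inj₂ ()) })
                           (adjDᴺ-nonadjacent m (4 + m) 1 λ { (inj₁ ()) ; (inj₂ ()) })
  ; path-cell  = path-cell
  ; last-cell  = trans (cong₂ _+_ (adjDᴺ-nonadjacent m (4 + m) (3 + m)
                                     λ { (inj₁ ()) ; (inj₂ (edge-path _ 4+m≤2+m)) → 2+n≰n 4+m≤2+m })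
                                  (adjDᴺ-nonadjacent m (4 + m) (4 + m) λ { (inj₁ ()) ; (inj₂ ()) }))
                       (sym (matBᴺ-off m (2 + m) (2 + m) (1+n≢n ∘ sym) (1+n≢n ∘ sym)))
  }
  where
  path-cell : ∀ t → t ≤ m → adjDᴺ m (4 + m) (2 + t) ≡ matBᴺ m (2 + m) (suc t)
  path-cell t t≤m with t ≟ m
  ... | yes refl = trans (adjDᴺ-adjacent m (4 + t) (2 + t) (inj₂ edge-end′)) (sym (matBᴺ-sub t t))
  ... | no t≢m   = trans (adjDᴺ-nonadjacent m (4 + m) (2 + t) ¬adjacent)
                         (sym (matBᴺ-off m (2 + m) (suc t) (<⇒≢ (s≤s (s≤s (m≤n⇒m≤1+n t≤m))))
                                                           (t≢m ∘ sym ∘ suc-injective ∘ suc-injective)))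
    where
    ¬adjacent : ¬ Adjacent (4 + m) (5 + m) (3 + t)
    ¬adjacent (inj₁ (edge-path _ _)) = 2+n≰n (≤-trans (n≤1+n _) t≤m)
    ¬adjacent (inj₂ edge-end′)       = t≢m refl
    ¬adjacent (inj₂ (edge-path _ _)) = 1+n≰n t≤m

-- The cells {1,2}, {3}, …, {n-1}, {n,n+1} of vertices, numbered 0, 1, …, n-2.
cell : ℕ → ℕ → ℕ
cell m i = pred i ⊓ (2 + m)

cell-path : ∀ {m s} → s ≤ m → cell m (2 + s) ≡ suc s
cell-path s≤m = m≤n⇒m⊓n≡m (s≤s (m≤n⇒m≤1+n s≤m))

cell-end₁ : ∀ m → cell m (3 + m) ≡ 2 + m
cell-end₁ m = ⊓-idem (2 + m)

cell-end₂ : ∀ m → cell m (4 + m) ≡ 2 + m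
cell-end₂ m = m≥n⇒m⊓n≡n (n≤1+n (2 + m))

quotientRow : ∀ m i → i ≤ 4 + m → QuotientRow m i (cell m i)
quotientRow m 0             _                   = quotientRow-start₁ m
quotientRow m 1             _                   = quotientRow-start₂ m
quotientRow m (suc (suc s)) (s≤s (s≤s s≤2+m)) with m≤n⇒m<n∨m≡n s≤2+m
... | inj₂ refl = subst (QuotientRow m (4 + m)) (sym (cell-end₂ m)) (quotientRow-end₂ m)
... | inj₁ (s≤s s≤1+m) with m≤n⇒m<n∨m≡n s≤1+m
...   | inj₂ refl       = subst (QuotientRow m (3 + m)) (sym (cell-end₁ m)) (quotientRow-end₁ m)
...   | inj₁ (s≤s s≤m) = subst (QuotientRow m (2 + s)) (sym (cell-path s≤m)) (quotientRow-path m s s≤m)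

sumᴺ-over-cells : ∀ m (f V : ℕ → ℕ) →
  sumᴺ (5 + m) (λ j → f j * V (cell m j)) ≡
  (f 0 + f 1) * V 0 + sumᴺ (suc m) (λ t → f (2 + t) * V (suc t)) + (f (3 + m) + f (4 + m)) * V (2 + m)
sumᴺ-over-cells m f V = begin
  h 0 + sumᴺ (4 + m) (λ j → h (suc j))
    ≡⟨ cong (h 0 +_) (sumᴺ-ends (2 + m) (λ j → h (suc j))) ⟩
  h 0 + (h 1 + sumᴺ (2 + m) (λ t → h (2 + t)) + h (4 + m))
    ≡⟨ cong (λ x → h 0 + (h 1 + x + h (4 + m))) (sumᴺ-last (suc m) (λ t → h (2 + t))) ⟩
  h 0 + (h 1 + (sumᴺ (suc m) (λ t → h (2 + t)) + h (3 + m)) + h (4 + m))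
    ≡⟨ cong (λ x → h 0 + (h 1 + (x + h (3 + m)) + h (4 + m)))
            (sumᴺ-cong (suc m) λ t t<1+m → cong (λ c → f (2 + t) * V c) (cell-path (≤-pred t<1+m))) ⟩
  h 0 + (h 1 + (S + h (3 + m)) + h (4 + m))
    ≡⟨ cong₂ (λ c c′ → h 0 + (h 1 + (S + f (3 + m) * V c) + f (4 + m) * V c′))
             (cell-end₁ m) (cell-end₂ m) ⟩
  f 0 * V 0 + (f 1 * V 0 + (S + f (3 + m) * V (2 + m)) + f (4 + m) * V (2 + m))
    ≡⟨ regroup (f 0) (f 1) (V 0) S (f (3 + m)) (f (4 + m)) (V (2 + m)) ⟩
  (f 0 + f 1) * V 0 + S + (f (3 + m) + f (4 + m)) * V (2 + m) ∎
  where
  open ≡-Reasoning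
  h : ℕ → ℕ
  h j = f j * V (cell m j)
  S : ℕ
  S = sumᴺ (suc m) (λ t → f (2 + t) * V (suc t))
  regroup : ∀ a b v s x y w → a * v + (b * v + (s + x * w) + y * w) ≡ (a + b) * v + s + (x + y) * w
  regroup = solve-∀

adjDᴺ-intertwines : ∀ m → Intertwines (adjDᴺ m) (5 + m) (matBᴺ m) (3 + m) (cell m)
adjDᴺ-intertwines m i i<5+m V = begin
  sumᴺ (5 + m) (λ j → a j * V (cell m j))
    ≡⟨ sumᴺ-over-cells m a V ⟩
  (a 0 + a 1) * V 0 + sumᴺ (suc m) (λ t → a (2 + t) * V (suc t)) + (a (3 + m) + a (4 + m)) * V (2 + m)
    ≡⟨ cong₂ _+_ (cong₂ _+_ (cong (_* V 0) first-cell)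
                             (sumᴺ-cong (suc m) λ t t<1+m → cong (_* V (suc t)) (path-cell t (≤-pred t<1+m))))
                 (cong (_* V (2 + m)) last-cell) ⟩
  b 0 * V 0 + sumᴺ (suc m) (λ t → b (suc t) * V (suc t)) + b (2 + m) * V (2 + m)
    ≡⟨ sumᴺ-ends (suc m) (λ q → b q * V q) ⟨
  sumᴺ (3 + m) (λ q → b q * V q) ∎
  where
  open ≡-Reasoning
  open QuotientRow (quotientRow m i (≤-pred i<5+m))
  a b : ℕ → ℕ
  a = adjDᴺ m i
  b = matBᴺ m (cell m i)

cell-suc : ∀ {m r} → r ≤ 2 + m → cell m (suc r) ≡ r
cell-suc = m≤n⇒m⊓n≡m

lemma2p6 : (n : ℕ) → 4 ≤ n →
    (r : ℕ) (r<n-1 : r < n ∸ 1) (r+1<n+1 : suc r < suc n) →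
    (k : ℕ) → k < n ∸ 1 →
    walk (adjD n) k (fromℕ< r+1<n+1) ≡ walk (matB n) k (fromℕ< r<n-1)
lemma2p6 (suc (suc (suc (suc m)))) (s≤s (s≤s (s≤s (s≤s _)))) r r<n-1 r+1<n+1 k _ = begin
  walk (adjD (4 + m)) k (fromℕ< r+1<n+1)
    ≡⟨ walk≡walkᴺ (adjDᴺ m) k (fromℕ< r+1<n+1) ⟩
  walkᴺ (adjDᴺ m) (5 + m) k (toℕ (fromℕ< r+1<n+1))
    ≡⟨ cong (walkᴺ (adjDᴺ m) (5 + m) k) (toℕ-fromℕ< r+1<n+1) ⟩
  walkᴺ (adjDᴺ m) (5 + m) k (suc r)
    ≡⟨ walkᴺ-quotient {φ = cell m} (adjDᴺ-intertwines m) k (suc r) r+1<n+1 ⟩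
  walkᴺ (matBᴺ m) (3 + m) k (cell m (suc r))
    ≡⟨ cong (walkᴺ (matBᴺ m) (3 + m) k) (cell-suc (≤-pred r<n-1)) ⟩
  walkᴺ (matBᴺ m) (3 + m) k r
    ≡⟨ cong (walkᴺ (matBᴺ m) (3 + m) k) (toℕ-fromℕ< r<n-1) ⟨
  walkᴺ (matBᴺ m) (3 + m) k (toℕ (fromℕ< r<n-1))
    ≡⟨ walk≡walkᴺ (matBᴺ m) k (fromℕ< r<n-1) ⟨
  walk (matB (4 + m)) k (fromℕ< r<n-1) ∎
  where open ≡-Reasoning
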